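{- Let $G$ be a graph, $A\subseteq V(G)$, and $F$ an induced subgraph of $G$ that is a forest. Then the number of $A$-important vertices of $F$ is at most $2\,\mathrm{sw}(A)$.
   Context: $\overline{A}=V(G)\setminus A$. A vertex $x\in V(F)\cap A$ is $A$-internal if it has at least two neighbors in $V(F)\cap\overline{A}$; it is $A$-pendant if it has exactly one neighbor $y$ in $V(F)\cap\overline{A}$ and $x$ is the only vertex of $V(F)\cap A$ adjacent to $y$; it is $A$-important if it is $A$-internal or $A$-pendant. $\mathrm{sw}(A)$ is the maximum size of an induced matching $M$ of $G$ (the subgraph of $G$ induced by the endpoints of $M$ has no edges besides $M$) each of whose edges has one endpoint in $A$ and the other in $\overline{A}$. -}

module Defs where

open import Data.Nat using (ℕ; _≤_; _*_)
open import Data.Fin using (Fin)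
open import Data.Fin.Subset using (Subset; _∈_; _∉_)
open import Data.List using (List; []; _∷_; _∷ʳ_; length; lookup)
open import Data.List.Relation.Unary.All using (All)
open import Data.List.Relation.Unary.Unique.Propositional using (Unique)
open import Data.List.Relation.Unary.Linked using (Linked)
open import Data.Product using (Σ; ∃; _×_; _,_; proj₁; proj₂)
open import Relation.Binary.PropositionalEquality using (_≡_; _≢_)
open import Relation.Nullary using (¬_)
open import Level using (0ℓ; suc)

record Graph (n : ℕ) : Set₁ where
  field
    E     : Fin n → Fin n → Set
    sym   : ∀ {x y} → E x y → E y x
    irrefl : ∀ {x} → ¬ E x x

module _ {n : ℕ} (G : Graph n) where
  open Graph G

  CycleIn : Subset n → List (Fin n) → Set
  CycleIn F [] = Data.Empty.⊥ where import Data.Empty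
  CycleIn F (u ∷ ws) =
    (3 ≤ length (u ∷ ws)) × Unique (u ∷ ws) × All (_∈ F) (u ∷ ws)
      × Linked E ((u ∷ ws) ∷ʳ u)

  IsForest : Subset n → Set
  IsForest F = ∀ vs → ¬ CycleIn F vs

  Internal : Subset n → Subset n → Fin n → Set
  Internal A F x = (x ∈ F) × (x ∈ A) ×
    Σ (Fin n) λ y → Σ (Fin n) λ z → (y ≢ z)
      × (y ∈ F) × (y ∉ A) × E x y
      × (z ∈ F) × (z ∉ A) × E x z

  Pendant : Subset n → Subset n → Fin n → Set
  Pendant A F x = (x ∈ F) × (x ∈ A) ×
    Σ (Fin n) λ y → (y ∈ F) × (y ∉ A) × E x y
      × (∀ y' → y' ∈ F → y' ∉ A → E x y' → y' ≡ y)
      × (∀ x' → x' ∈ F → x' ∈ A → E x' y → x' ≡ x)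

  Important : Subset n → Subset n → Fin n → Set
  Important A F x = Data.Sum._⊎_ (Internal A F x) (Pendant A F x)
    where import Data.Sum

  CrossInducedMatching : Subset n → List (Fin n × Fin n) → Set
  CrossInducedMatching A M =
    All (λ e → (proj₁ e ∈ A) × (proj₂ e ∉ A) × E (proj₁ e) (proj₂ e)) M
    × Unique (endpoints M)
    × (∀ i j → i ≢ j →
         ¬ E (proj₁ (lookup M i)) (proj₁ (lookup M j))
       × ¬ E (proj₁ (lookup M i)) (proj₂ (lookup M j))
       × ¬ E (proj₂ (lookup M i)) (proj₁ (lookup M j))
       × ¬ E (proj₂ (lookup M i)) (proj₂ (lookup M j)))
    where
    endpoints : List (Fin n × Fin n) → List (Fin n)
    endpoints [] = []
    endpoints ((a , b) ∷ es) = a ∷ b ∷ endpoints es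

  IsSw : Subset n → ℕ → Set
  IsSw A k = (Σ (List (Fin n × Fin n)) λ M → CrossInducedMatching A M × length M ≡ k)
           × (∀ M → CrossInducedMatching A M → length M ≤ k)

-- Greedily pair an important vertex x with a private neighbour, a vertex of F ∖ A whose
-- only neighbour among the important vertices not yet paired is x, and repeat.  If there
-- is none, those vertices and their neighbours in F ∖ A span a subgraph of F of minimum
-- degree 2, which a forest does not have.  This gives a matching of cross edges as large
-- as the set of important vertices.  Greedily again, keep a matching edge adjacent to at
-- most one other and discard that one; if no such edge exists, the endpoints adjacent to
-- other matching edges again span a subgraph of minimum degree 2.  What is kept is an
-- induced cross matching of at least half the size.

module Submission where

open import Defs
open import Level using (0ℓ)
open import Data.Nat using (ℕ; zero; suc; _+_; _*_; _≤_; _<_; z≤n; s≤s; _≤?_)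
open import Data.Nat.Properties
  using (≤-trans; ≤-refl; ≤-pred; <-irrefl; +-mono-≤; *-monoʳ-≤; *-distribˡ-+; +-suc; ≰⇒>; module ≤-Reasoning)
open import Data.Nat.Induction using (<-wellFounded)
open import Data.Fin using (Fin) renaming (zero to fzero; suc to fsuc)
open import Data.Fin.Properties using (any?; injective⇒≤) renaming (_≟_ to _≟ᶠ_)
open import Data.Fin.Subset using (Subset; _∈_; _∉_)
open import Data.Fin.Subset.Properties using (_∈?_)
open import Data.List using (List; []; _∷_; [_]; _++_; length; lookup; filter; concatMap)
open import Data.List.Properties using (filter-notAll; filter-all)
open import Data.List.Relation.Unary.All as All using (All; []; _∷_)
import Data.List.Relation.Unary.All.Properties as All
open import Data.List.Relation.Unary.All.Properties using (¬Any⇒All¬; ¬All⇒Any¬; All-swap; anti-mono; all-filter)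
open import Data.List.Relation.Unary.Any as Any using (Any; here; there)
open import Data.List.Relation.Unary.Any.Properties using (swap)
open import Data.List.Relation.Unary.AllPairs using (AllPairs; []; _∷_)
import Data.List.Relation.Unary.AllPairs as AllPairs
import Data.List.Relation.Unary.AllPairs.Properties as AllPairs
open import Data.List.Relation.Unary.Unique.Propositional using (Unique)
open import Data.List.Relation.Unary.Linked using (Linked; []; [-]; _∷_)
open import Data.List.Membership.Propositional using (find; lose) renaming (_∈_ to _∈ˡ_)
open import Data.List.Membership.Propositional.Properties using (∈-filter⁻; ∈-AllPairs₂; ∈-lookup)
open import Data.List.Relation.Binary.Subset.Propositional using (_⊆_)
open import Data.List.Relation.Binary.Subset.Propositional.Properties using (filter-⊆)
open import Data.Product using (∃; ∃₂; _×_; _,_; proj₁; proj₂)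
open import Data.Product.Properties using (≡-dec)
open import Data.Sum using (_⊎_; inj₁; inj₂)
open import Data.Empty using (⊥; ⊥-elim)
open import Function using (_∘_)
import Induction.WellFounded as WF
import Relation.Binary.Construct.On as On
open import Relation.Binary.Core using (Rel)
open import Relation.Binary.Definitions using (Symmetric; DecidableEquality; Decidable)
open import Relation.Binary.PropositionalEquality using (_≡_; _≢_; refl; sym; trans; cong; subst; ≢-sym)
open import Relation.Nullary using (¬_; Dec; yes; no; ¬?)
open import Relation.Nullary.Decidable using (decidable-stable; _×-dec_; _→-dec_; ¬¬-excluded-middle)
open import Relation.Unary.Properties using (∁?)

module _ {X : Set} where

  length-rec : (P : List X → Set) →
    (∀ xs → (∀ ys → length ys < length xs → P ys) → P xs) → ∀ xs → P xs
  length-rec P step =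
    WF.All.wfRec (On.wellFounded length <-wellFounded) 0ℓ P (λ xs rec → step xs (λ ys → rec {ys}))

  length-partition : ∀ {P : X → Set} (P? : ∀ x → Dec (P x)) xs →
    length xs ≡ length (filter P? xs) + length (filter (∁? P?) xs)
  length-partition P? [] = refl
  length-partition P? (x ∷ xs) with P? x
  ... | yes _ = cong suc (length-partition P? xs)
  ... | no  _ = trans (cong suc (length-partition P? xs)) (sym (+-suc _ _))

  AllPairs-∈ : ∀ {R : Rel X 0ℓ} → Symmetric R → ∀ {xs x y} → AllPairs R xs →
    x ∈ˡ xs → y ∈ˡ xs → x ≢ y → R x y
  AllPairs-∈ R-sym ps x∈ y∈ x≢y with ∈-AllPairs₂ ps x∈ y∈
  ... | inj₁ x≡y        = ⊥-elim (x≢y x≡y)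
  ... | inj₂ (inj₁ Rxy) = Rxy
  ... | inj₂ (inj₂ Ryx) = R-sym Ryx

  AllPairs-lookup : ∀ {R : Rel X 0ℓ} → Symmetric R → ∀ {xs} → AllPairs R xs →
    ∀ i j → i ≢ j → R (lookup xs i) (lookup xs j)
  AllPairs-lookup R-sym (_  ∷ _)  fzero    fzero    i≢j = ⊥-elim (i≢j refl)
  AllPairs-lookup R-sym (px ∷ _)  fzero    (fsuc j) _   = All.lookup px (∈-lookup j)
  AllPairs-lookup R-sym (px ∷ _)  (fsuc i) fzero    _   = R-sym (All.lookup px (∈-lookup i))
  AllPairs-lookup R-sym (_  ∷ ps) (fsuc i) (fsuc j) i≢j =
    AllPairs-lookup R-sym ps i j (i≢j ∘ cong fsuc)

  Unique-lookup-injective : ∀ {xs} → Unique xs → ∀ {i j} → lookup xs i ≡ lookup xs j → i ≡ j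
  Unique-lookup-injective u {i} {j} eq with i ≟ᶠ j
  ... | yes i≡j = i≡j
  ... | no  i≢j = ⊥-elim (AllPairs-lookup ≢-sym u i j i≢j eq)

  module _ {c : X} where

    prefixThrough : ∀ {xs} → c ∈ˡ xs → List X
    prefixThrough {x ∷ _} (here _)  = [ x ]
    prefixThrough {x ∷ _} (there m) = x ∷ prefixThrough m

    All-prefixThrough : ∀ {P : X → Set} {xs} (m : c ∈ˡ xs) → All P xs → All P (prefixThrough m)
    All-prefixThrough (here _)  (px ∷ _)  = px ∷ []
    All-prefixThrough (there m) (px ∷ ps) = px ∷ All-prefixThrough m ps

    AllPairs-prefixThrough : ∀ {R : Rel X 0ℓ} {xs} (m : c ∈ˡ xs) → AllPairs R xs →
      AllPairs R (prefixThrough m)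
    AllPairs-prefixThrough (here _)  (_  ∷ _)  = [] ∷ []
    AllPairs-prefixThrough (there m) (px ∷ ps) = All-prefixThrough m px ∷ AllPairs-prefixThrough m ps

    Linked-prefixThrough : ∀ {R : Rel X 0ℓ} {q z xs} (m : c ∈ˡ xs) → Linked R (q ∷ xs) → R c z →
      Linked R (q ∷ prefixThrough m ++ [ z ])
    Linked-prefixThrough (here refl) (r ∷ _)  rcz = r ∷ rcz ∷ [-]
    Linked-prefixThrough (there m)   (r ∷ rs) rcz = r ∷ Linked-prefixThrough m rs rcz

  module _ (_≟_ : DecidableEquality X) where

    remove : X → List X → List X
    remove x = filter (λ y → ¬? (y ≟ x))

    ∈-remove⁻ : ∀ {x y xs} → y ∈ˡ remove x xs → y ∈ˡ xs × y ≢ x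
    ∈-remove⁻ {x} = ∈-filter⁻ (λ y → ¬? (y ≟ x))

    remove-< : ∀ {x xs} → x ∈ˡ xs → length (remove x xs) < length xs
    remove-< {x} {xs} x∈ = filter-notAll (λ y → ¬? (y ≟ x)) xs (Any.map (λ x≡y y≢x → y≢x (sym x≡y)) x∈)

    length-remove : ∀ x {xs} → Unique xs → length xs ≤ suc (length (remove x xs))
    length-remove x {[]}     _ = z≤n
    length-remove x {y ∷ ys} (y∉ys ∷ u) with y ≟ x
    ... | yes refl = s≤s (subst (λ l → length ys ≤ length l)
                       (sym (filter-all (λ z → ¬? (z ≟ x)) (All.map ≢-sym y∉ys))) ≤-refl)
    ... | no _     = s≤s (length-remove x u)

Unique⇒length≤ : ∀ {n} {xs : List (Fin n)} → Unique xs → length xs ≤ n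
Unique⇒length≤ u = injective⇒≤ (Unique-lookup-injective u)

¬¬-∀-Fin : ∀ n {P : Fin n → Set} → (∀ i → ¬ ¬ P i) → ¬ ¬ (∀ i → P i)
¬¬-∀-Fin zero    _   k = k (λ ())
¬¬-∀-Fin (suc n) ¬¬P k =
  ¬¬P fzero λ P0 → ¬¬-∀-Fin n (¬¬P ∘ fsuc) λ Psuc → k λ { fzero → P0 ; (fsuc i) → Psuc i }

-- CrossInducedMatching refers to a local function endpoints; unification against the
-- type of its second component recovers that function under a name.
listFunction : ∀ {X Y : Set} {f : X → List Y} {P : X → Set} → (∀ x → P x → Unique (f x)) → X → List Y
listFunction {f = f} _ = f

A≢Ā : ∀ {n} {A : Subset n} {x y} → x ∈ A → y ∉ A → x ≢ y
A≢Ā x∈A y∉A refl = y∉A x∈A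

Edge : ℕ → Set
Edge n = Fin n × Fin n

ends : ∀ {n} → Edge n → List (Fin n)
ends (u , v) = u ∷ v ∷ []

Disjoint : ∀ {n} → Rel (Edge n) 0ℓ
Disjoint e e′ = All (λ u → All (u ≢_) (ends e′)) (ends e)

Disjoint-sym : ∀ {n} → Symmetric (Disjoint {n})
Disjoint-sym d = All.map (All.map ≢-sym) (All-swap d)

Disjoint⇒≢ : ∀ {n} {e e′ : Edge n} → Disjoint e e′ → e ≢ e′
Disjoint⇒≢ ((u≢u ∷ _) ∷ _) refl = u≢u refl

module _ {n : ℕ} (G : Graph n) where
  open Graph G renaming (sym to E-sym)

  E⇒≢ : ∀ {x y} → E x y → x ≢ y
  E⇒≢ e refl = irrefl e

  TwoNeighboursIn : (Fin n → Set) → Fin n → Set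
  TwoNeighboursIn V v = ∃₂ λ u w → u ≢ w × E v u × E v w × V u × V w

  module _ {F : Subset n} (forest : IsForest G F) where

    chord⇒cycle : ∀ {v p ps c} → Unique (v ∷ p ∷ ps) → Linked E (v ∷ p ∷ ps) →
      All (_∈ F) (v ∷ p ∷ ps) → (c∈ : c ∈ˡ ps) → E v c → CycleIn G F (v ∷ p ∷ prefixThrough c∈)
    chord⇒cycle ((v∉ ∷ v∉ps) ∷ (p∉ps ∷ u)) (Evp ∷ l) (v∈F ∷ p∈F ∷ ps∈F) c∈ Evc =
        s≤s (s≤s (prefix-nonempty c∈))
      , ((v∉ ∷ All-prefixThrough c∈ v∉ps) ∷ (All-prefixThrough c∈ p∉ps ∷ AllPairs-prefixThrough c∈ u))
      , (v∈F ∷ p∈F ∷ All-prefixThrough c∈ ps∈F)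
      , Evp ∷ Linked-prefixThrough c∈ l (E-sym Evc)
      where
      prefix-nonempty : ∀ {c xs} (m : c ∈ˡ xs) → 0 < length (prefixThrough m)
      prefix-nonempty (here _)  = s≤s z≤n
      prefix-nonempty (there _) = s≤s z≤n

    module _ {V : Fin n → Set} (V⊆F : ∀ {v} → V v → v ∈ F)
             (twoNeighbours : ∀ {v} → V v → TwoNeighboursIn V v) where

      record Path (k : ℕ) : Set where
        constructor path
        field
          end      : Fin n
          earlier  : List (Fin n)
          length≡  : length earlier ≡ k
          unique   : Unique (end ∷ earlier)
          linked   : Linked E (end ∷ earlier)
          inside   : All V (end ∷ earlier)

      neighbourAvoiding : ∀ {v} → V v → ∀ p → ∃ λ c → c ≢ p × E v c × V c
      neighbourAvoiding Vv p with twoNeighbours Vv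
      ... | u , w , u≢w , Evu , Evw , Vu , Vw with u ≟ᶠ p
      ...   | yes refl = w , ≢-sym u≢w , Evw , Vw
      ...   | no  u≢p  = u , u≢p , Evu , Vu

      extend : ∀ {k} → Path k → Path (suc k)
      extend (path v [] refl u l (Vv ∷ [])) with twoNeighbours Vv
      ... | c , _ , _ , Evc , _ , Vc , _ =
        path c (v ∷ []) refl ((≢-sym (E⇒≢ Evc) ∷ []) ∷ u) (E-sym Evc ∷ l) (Vc ∷ Vv ∷ [])
      extend (path v (p ∷ ps) refl u l Vs@(Vv ∷ _)) with neighbourAvoiding Vv p
      ... | c , c≢p , Evc , Vc with Any.any? (c ≟ᶠ_) ps
      ...   | yes c∈ps = ⊥-elim (forest _ (chord⇒cycle u l (All.map V⊆F Vs) c∈ps Evc))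
      ...   | no  c∉ps = path c (v ∷ p ∷ ps) refl
                  ((≢-sym (E⇒≢ Evc) ∷ c≢p ∷ ¬Any⇒All¬ ps c∉ps) ∷ u) (E-sym Evc ∷ l) (Vc ∷ Vs)

      pathOfLength : ∀ {v} → V v → ∀ k → Path k
      pathOfLength {v} Vv zero    = path v [] refl ([] ∷ []) [-] (Vv ∷ [])
      pathOfLength     Vv (suc k) = extend (pathOfLength Vv k)

      minDegree2⇒empty : ∀ {v} → ¬ V v
      minDegree2⇒empty Vv with pathOfLength Vv n
      ... | path _ _ len≡n u _ _ = <-irrefl len≡n (Unique⇒length≤ u)

  IsEdge : Edge n → Set
  IsEdge e = E (proj₁ e) (proj₂ e)

  EdgeIn : Subset n → Edge n → Set
  EdgeIn F e = IsEdge e × All (_∈ F) (ends e)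

  Adjacent : Rel (Edge n) 0ℓ
  Adjacent e e′ = Any (λ u → Any (E u) (ends e′)) (ends e)

  Adjacent-refl : ∀ {e} → IsEdge e → Adjacent e e
  Adjacent-refl Euv = here (there (here Euv))

  Adjacent-sym : Symmetric Adjacent
  Adjacent-sym = Any.map (Any.map E-sym) ∘ swap

  Adjacent⇒edge : ∀ {e e′} → Adjacent e e′ → ∃₂ λ u v → u ∈ˡ ends e × v ∈ˡ ends e′ × E u v
  Adjacent⇒edge a with find a
  ... | u , u∈ , a′ with find a′
  ...   | v , v∈ , Euv = u , v , u∈ , v∈ , Euv

  partner : ∀ {e v} → IsEdge e → v ∈ˡ ends e →
    ∃ λ w → w ∈ˡ ends e × E v w × (∀ {x} → x ∈ˡ ends e → x ≡ v ⊎ x ≡ w)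
  partner Euv (here refl)         = _ , there (here refl) , Euv ,
    λ { (here refl) → inj₁ refl ; (there (here refl)) → inj₂ refl }
  partner Euv (there (here refl)) = _ , here refl , E-sym Euv ,
    λ { (here refl) → inj₂ refl ; (there (here refl)) → inj₁ refl }

  nonadjacent⇒disjoint : ∀ {e e′} → IsEdge e′ → ¬ Adjacent e e′ → Disjoint e e′
  nonadjacent⇒disjoint edge ¬adj = All.tabulate λ u∈ → All.tabulate λ { v∈ refl →
    let w , w∈ , Euw , _ = partner edge v∈ in ¬adj (lose u∈ (lose w∈ Euw)) }

  endpointsOf : Subset n → List (Edge n) → List (Fin n)
  endpointsOf A = listFunction (λ M (c : CrossInducedMatching G A M) → proj₁ (proj₂ c))

  endpointsOf≡concatMap : ∀ A M → endpointsOf A M ≡ concatMap ends M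
  endpointsOf≡concatMap A []      = refl
  endpointsOf≡concatMap A (e ∷ M) = cong (λ l → proj₁ e ∷ proj₂ e ∷ l) (endpointsOf≡concatMap A M)

  Important⇒∈F : ∀ {A F x} → Important G A F x → x ∈ F
  Important⇒∈F (inj₁ internal) = proj₁ internal
  Important⇒∈F (inj₂ pendant)  = proj₁ pendant

  Important⇒∈A : ∀ {A F x} → Important G A F x → x ∈ A
  Important⇒∈A (inj₁ internal) = proj₁ (proj₂ internal)
  Important⇒∈A (inj₂ pendant)  = proj₁ (proj₂ pendant)

  CrossEdge : Subset n → Subset n → Edge n → Set
  CrossEdge A F e = proj₁ e ∈ A × proj₂ e ∉ A × EdgeIn F e

  unique-endpoints : ∀ {A F M} → All (CrossEdge A F) M → AllPairs Disjoint M → Unique (endpointsOf A M)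
  unique-endpoints {A} {M = M} cross disj = subst Unique (sym (endpointsOf≡concatMap A M))
    (AllPairs.concat⁺ (All.map⁺ (All.map (λ (_ , _ , Euv , _) → (E⇒≢ Euv ∷ []) ∷ [] ∷ []) cross))
                      (AllPairs.map⁺ disj))

  crossInducedMatching : ∀ {A F M} → All (CrossEdge A F) M → AllPairs Disjoint M →
    AllPairs (λ e e′ → ¬ Adjacent e e′) M → CrossInducedMatching G A M
  crossInducedMatching cross disj nonadj =
      All.map (λ (u∈A , v∉A , Euv , _) → u∈A , v∉A , Euv) cross
    , unique-endpoints cross disj
    , λ i j i≢j → noEdges (AllPairs-lookup (λ ¬adj → ¬adj ∘ Adjacent-sym) nonadj i j i≢j)
    where
    noEdges : ∀ {e e′} → ¬ Adjacent e e′ →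
      ¬ E (proj₁ e) (proj₁ e′) × ¬ E (proj₁ e) (proj₂ e′) × ¬ E (proj₂ e) (proj₁ e′) × ¬ E (proj₂ e) (proj₂ e′)
    noEdges ¬adj = ¬adj ∘ here ∘ here , ¬adj ∘ here ∘ there ∘ here
                 , ¬adj ∘ there ∘ here ∘ here , ¬adj ∘ there ∘ here ∘ there ∘ here

  module _ (E? : Decidable E) {F : Subset n} (forest : IsForest G F) where

    adjacent? : Decidable Adjacent
    adjacent? e e′ = Any.any? (λ u → Any.any? (E? u) (ends e′)) (ends e)

    _≟ₑ_ : DecidableEquality (Edge n)
    _≟ₑ_ = ≡-dec _≟ᶠ_ _≟ᶠ_

    Crowded : List (Edge n) → Edge n → Set
    Crowded M e = ∃₂ λ e₁ e₂ → e₁ ∈ˡ M × e₂ ∈ˡ M × e₁ ≢ e₂ × e₁ ≢ e × e₂ ≢ e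
      × Adjacent e e₁ × Adjacent e e₂

    crowded : ∀ {M e} → Unique M → 2 < length (filter (adjacent? e) M) → Crowded M e
    crowded {M} {e} u 2<len = pick (remove _≟ₑ_ e N)
      (AllPairs.filter⁺ _ (AllPairs.filter⁺ _ u)) (∈-remove⁻ _≟ₑ_)
      (≤-pred (≤-trans 2<len (length-remove _≟ₑ_ e (AllPairs.filter⁺ _ u))))
      where
      N = filter (adjacent? e) M
      pick : ∀ l → Unique l → (∀ {e″} → e″ ∈ˡ l → e″ ∈ˡ N × e″ ≢ e) → 2 ≤ length l → Crowded M e
      pick (e₁ ∷ e₂ ∷ _) ((e₁≢e₂ ∷ _) ∷ _) inN _ =
        let e₁∈N , e₁≢e = inN (here refl)
            e₂∈N , e₂≢e = inN (there (here refl))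
            e₁∈M , adj₁ = ∈-filter⁻ (adjacent? e) e₁∈N
            e₂∈M , adj₂ = ∈-filter⁻ (adjacent? e) e₂∈N
        in e₁ , e₂ , e₁∈M , e₂∈M , e₁≢e₂ , e₁≢e , e₂≢e , adj₁ , adj₂
      pick (_ ∷ []) _ _ (s≤s ())

    Joined : List (Edge n) → Fin n → Set
    Joined M v = ∃ λ e → e ∈ˡ M × v ∈ˡ ends e ×
      ∃ λ e′ → e′ ∈ˡ M × e′ ≢ e × ∃ λ u → u ∈ˡ ends e′ × E v u

    -- Contracting the edges of M would leave a graph of minimum degree 2; in G itself, the
    -- endpoints joined to another edge of M span a subgraph of minimum degree 2.
    matching-not-crowded : ∀ {M e₀} → All (EdgeIn F) M → AllPairs Disjoint M → e₀ ∈ˡ M →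
      (∀ {e} → e ∈ˡ M → Crowded M e) → ⊥
    matching-not-crowded {M} {e₀} edges disj e₀∈ crowd =
      let _ , _ , e₁∈ , _ , _ , e₁≢e₀ , _ , adj , _ = crowd e₀∈
          x , z , x∈ , z∈ , Exz = Adjacent⇒edge adj
      in minDegree2⇒empty forest inF twoNeighbours (e₀ , e₀∈ , x∈ , _ , e₁∈ , e₁≢e₀ , z , z∈ , Exz)
      where
      inF : ∀ {v} → Joined M v → v ∈ F
      inF (e , e∈ , v∈ , _) = All.lookup (proj₂ (All.lookup edges e∈)) v∈

      joined-back : ∀ {e e′ v u} → e ∈ˡ M → e′ ∈ˡ M → e′ ≢ e → v ∈ˡ ends e → u ∈ˡ ends e′ →
        E v u → Joined M u
      joined-back e∈ e′∈ e′≢e v∈ u∈ Evu = _ , e′∈ , u∈ , _ , e∈ , ≢-sym e′≢e , _ , v∈ , E-sym Evu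

      ends-distinct : ∀ {e e′ u v} → e ∈ˡ M → e′ ∈ˡ M → e ≢ e′ → u ∈ˡ ends e → v ∈ˡ ends e′ → u ≢ v
      ends-distinct e∈ e′∈ e≢e′ u∈ v∈ = All.lookup (All.lookup (AllPairs-∈ Disjoint-sym disj e∈ e′∈ e≢e′) u∈) v∈

      viaPartner : ∀ {e e′ v u w} → e ∈ˡ M → e′ ∈ˡ M → e′ ≢ e → v ∈ˡ ends e → u ∈ˡ ends e′ →
        w ∈ˡ ends e → E v u → E v w → Joined M w → TwoNeighboursIn (Joined M) v
      viaPartner e∈ e′∈ e′≢e v∈ u∈ w∈ Evu Evw Jw =
        _ , _ , ends-distinct e′∈ e∈ e′≢e u∈ w∈ , Evu , Evw , joined-back e∈ e′∈ e′≢e v∈ u∈ Evu , Jw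

      twoNeighbours : ∀ {v} → Joined M v → TwoNeighboursIn (Joined M) v
      twoNeighbours {v} (e , e∈ , v∈ , e′ , e′∈ , e′≢e , u , u∈ , Evu)
        with partner (proj₁ (All.lookup edges e∈)) v∈ | crowd e∈
      ... | w , w∈ , Evw , onlyVW | e₁ , e₂ , e₁∈ , e₂∈ , e₁≢e₂ , e₁≢e , e₂≢e , adj₁ , adj₂
        with Adjacent⇒edge adj₁ | Adjacent⇒edge adj₂
      ... | x₁ , z₁ , x₁∈ , z₁∈ , Exz₁ | x₂ , z₂ , x₂∈ , z₂∈ , Exz₂
        with onlyVW x₁∈ | onlyVW x₂∈
      ... | inj₁ refl | inj₁ refl =
        z₁ , z₂ , ends-distinct e₁∈ e₂∈ e₁≢e₂ z₁∈ z₂∈ , Exz₁ , Exz₂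
        , joined-back e∈ e₁∈ e₁≢e v∈ z₁∈ Exz₁ , joined-back e∈ e₂∈ e₂≢e v∈ z₂∈ Exz₂
      ... | inj₂ refl | _ =
        viaPartner e∈ e′∈ e′≢e v∈ u∈ w∈ Evu Evw (_ , e∈ , w∈ , _ , e₁∈ , e₁≢e , _ , z₁∈ , Exz₁)
      ... | inj₁ refl | inj₂ refl =
        viaPartner e∈ e′∈ e′≢e v∈ u∈ w∈ Evu Evw (_ , e∈ , w∈ , _ , e₂∈ , e₂≢e , _ , z₂∈ , Exz₂)

    InducedSubmatching : List (Edge n) → Set
    InducedSubmatching M₀ = ∃ λ M → M ⊆ M₀ × AllPairs Disjoint M
      × AllPairs (λ e e′ → ¬ Adjacent e e′) M × length M₀ ≤ 2 * length M

    NonNeighbours : Edge n → List (Edge n) → List (Edge n)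
    NonNeighbours e = filter (∁? (adjacent? e))

    keep-sparse : ∀ {M₀ e} → All (EdgeIn F) M₀ → e ∈ˡ M₀ → length (filter (adjacent? e) M₀) ≤ 2 →
      InducedSubmatching (NonNeighbours e M₀) → InducedSubmatching M₀
    keep-sparse {M₀} {e} edges e∈ few (M , M⊆rest , disjM , nonadjM , rest≤2M) =
      e ∷ M , ⊆-cons , All.tabulate disjoint ∷ disjM
      , anti-mono M⊆rest (all-filter (∁? (adjacent? e)) M₀) ∷ nonadjM , bound
      where
      ⊆-cons : e ∷ M ⊆ M₀
      ⊆-cons (here refl) = e∈
      ⊆-cons (there e″∈) = filter-⊆ (∁? (adjacent? e)) M₀ (M⊆rest e″∈)
      disjoint : ∀ {e″} → e″ ∈ˡ M → Disjoint e e″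
      disjoint e″∈M = let e″∈M₀ , ¬adj = ∈-filter⁻ (∁? (adjacent? e)) (M⊆rest e″∈M) in
        nonadjacent⇒disjoint (proj₁ (All.lookup edges e″∈M₀)) ¬adj
      bound : length M₀ ≤ 2 * suc (length M)
      bound = begin
        length M₀                                         ≡⟨ length-partition (adjacent? e) M₀ ⟩
        length (filter (adjacent? e) M₀) + length (NonNeighbours e M₀) ≤⟨ +-mono-≤ few rest≤2M ⟩
        2 + 2 * length M                                  ≡⟨ *-distribˡ-+ 2 1 (length M) ⟨
        2 * suc (length M)                                ∎
        where open ≤-Reasoning

    NonNeighbours-shorter : ∀ {M₀ e} → All (EdgeIn F) M₀ → e ∈ˡ M₀ →
      length (NonNeighbours e M₀) < length M₀
    NonNeighbours-shorter {M₀} {e} edges e∈ = filter-notAll (∁? (adjacent? e)) M₀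
      (lose e∈ (λ ¬adj → ¬adj (Adjacent-refl (proj₁ (All.lookup edges e∈)))))

    induced-submatching : ∀ M₀ → All (EdgeIn F) M₀ → AllPairs Disjoint M₀ → InducedSubmatching M₀
    induced-submatching = length-rec _ step
      where
      step : ∀ M₀ → (∀ M → length M < length M₀ → All (EdgeIn F) M → AllPairs Disjoint M →
               InducedSubmatching M) →
             All (EdgeIn F) M₀ → AllPairs Disjoint M₀ → InducedSubmatching M₀
      step [] _ _ _ = [] , (λ ()) , [] , [] , z≤n
      step M₀@(_ ∷ _) rec edges disj
        with Any.any? (λ e → length (filter (adjacent? e) M₀) ≤? 2) M₀
      ... | no dense = ⊥-elim (matching-not-crowded edges disj (here refl) λ e∈ →
              crowded (AllPairs.map Disjoint⇒≢ disj) (≰⇒> (All.lookup (¬Any⇒All¬ M₀ dense) e∈)))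
      ... | yes sparse =
        let e , e∈ , few = find sparse
        in keep-sparse edges e∈ few (rec _ (NonNeighbours-shorter edges e∈)
             (All.filter⁺ (∁? (adjacent? e)) edges) (AllPairs.filter⁺ (∁? (adjacent? e)) disj))

  module _ (E? : Decidable E) (A F : Subset n) (forest : IsForest G F) where

    PrivateNeighbour : List (Fin n) → Fin n → Fin n → Set
    PrivateNeighbour xs x y = y ∈ F × y ∉ A × E x y × All (λ x′ → E x′ y → x′ ≡ x) xs

    privateNeighbour? : ∀ xs x y → Dec (PrivateNeighbour xs x y)
    privateNeighbour? xs x y =
      (y ∈? F) ×-dec ¬? (y ∈? A) ×-dec E? x y ×-dec All.all? (λ x′ → E? x′ y →-dec (x′ ≟ᶠ x)) xs

    -- Otherwise xs and its neighbours in F ∖ A span a subgraph of minimum degree 2: each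
    -- y has two neighbours in xs, and each x is internal since pendant vertices have a
    -- private neighbour.
    private-neighbour-exists : ∀ {xs x₀} → x₀ ∈ˡ xs → All (Important G A F) xs →
      ∃₂ λ x y → x ∈ˡ xs × PrivateNeighbour xs x y
    private-neighbour-exists {xs} x₀∈ important
      with any? (λ y → Any.any? (λ x → privateNeighbour? xs x y) xs)
    ... | yes (y , hasPrivate) = let x , x∈ , p = find hasPrivate in x , y , x∈ , p
    ... | no none = ⊥-elim (minDegree2⇒empty forest inF twoNeighbours (inj₁ x₀∈))
      where
      Core : Fin n → Set
      Core v = v ∈ˡ xs ⊎ (v ∈ F × v ∉ A × ∃ λ x → x ∈ˡ xs × E x v)

      inF : ∀ {v} → Core v → v ∈ F
      inF (inj₁ v∈)         = Important⇒∈F (All.lookup important v∈)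
      inF (inj₂ (v∈F , _)) = v∈F

      not-private : ∀ {x y} → x ∈ˡ xs → ¬ PrivateNeighbour xs x y
      not-private x∈ p = none (_ , lose x∈ p)

      twoNeighbours : ∀ {v} → Core v → TwoNeighboursIn Core v
      twoNeighbours {x} (inj₁ x∈) with All.lookup important x∈
      ... | inj₁ (_ , _ , y , z , y≢z , y∈F , y∉A , Exy , z∈F , z∉A , Exz) =
        y , z , y≢z , Exy , Exz , inj₂ (y∈F , y∉A , x , x∈ , Exy) , inj₂ (z∈F , z∉A , x , x∈ , Exz)
      ... | inj₂ (_ , _ , y , y∈F , y∉A , Exy , _ , onlyX) =
        ⊥-elim (not-private x∈ (y∈F , y∉A , Exy , All.tabulate λ {x′} x′∈ →
          onlyX x′ (Important⇒∈F (All.lookup important x′∈)) (Important⇒∈A (All.lookup important x′∈))))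
      twoNeighbours {y} (inj₂ (y∈F , y∉A , x , x∈ , Exy)) =
        let x′ , x′∈ , ¬onlyX = find (¬All⇒Any¬ (λ x′ → E? x′ y →-dec (x′ ≟ᶠ x)) xs
                                  (λ onlyX → not-private x∈ (y∈F , y∉A , Exy , onlyX)))
            Ex′y = decidable-stable (E? x′ y) (λ ¬Ex′y → ¬onlyX (⊥-elim ∘ ¬Ex′y))
        in x , x′ , (λ x≡x′ → ¬onlyX (λ _ → sym x≡x′)) , E-sym Exy , E-sym Ex′y , inj₁ x∈ , inj₁ x′∈

    ImportantMatching : List (Fin n) → Set
    ImportantMatching xs = ∃ λ M → All (CrossEdge A F) M × AllPairs Disjoint M
      × All (λ e → proj₁ e ∈ˡ xs) M × length xs ≤ length M

    match-private : ∀ {xs x y} → Unique xs → All (Important G A F) xs → x ∈ˡ xs →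
      PrivateNeighbour xs x y → ImportantMatching (remove _≟ᶠ_ x xs) → ImportantMatching xs
    match-private {xs} {x} {y} u important x∈ (y∈F , y∉A , Exy , onlyX) (M , cross , disj , firsts , len) =
        (x , y) ∷ M
      , (x∈A , y∉A , Exy , Important⇒∈F (All.lookup important x∈) ∷ y∈F ∷ []) ∷ cross
      , All.tabulate disjoint ∷ disj
      , x∈ ∷ All.map (proj₁ ∘ ∈-remove⁻ _≟ᶠ_) firsts
      , ≤-trans (length-remove _≟ᶠ_ x u) (s≤s len)
      where
      x∈A = Important⇒∈A (All.lookup important x∈)
      disjoint : ∀ {e′} → e′ ∈ˡ M → Disjoint (x , y) e′
      disjoint e′∈ with All.lookup cross e′∈ | ∈-remove⁻ _≟ᶠ_ (All.lookup firsts e′∈)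
      ... | x′∈A , y′∉A , Ex′y′ , _ | x′∈ , x′≢x =
          (≢-sym x′≢x ∷ A≢Ā x∈A y′∉A ∷ [])
        ∷ (≢-sym (A≢Ā x′∈A y∉A) ∷ (λ { refl → x′≢x (All.lookup onlyX x′∈ Ex′y′) }) ∷ [])
        ∷ []

    important⇒matching : ∀ xs → Unique xs → All (Important G A F) xs → ImportantMatching xs
    important⇒matching = length-rec _ step
      where
      step : ∀ xs → (∀ ys → length ys < length xs → Unique ys → All (Important G A F) ys →
               ImportantMatching ys) →
             Unique xs → All (Important G A F) xs → ImportantMatching xs
      step [] _ _ _ = [] , [] , [] , [] , z≤n
      step (_ ∷ _) rec u important =
        let x , _ , x∈ , p = private-neighbour-exists (here refl) important
            keep = λ y → ¬? (y ≟ᶠ x)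
        in match-private u important x∈ p
             (rec _ (remove-< _≟ᶠ_ x∈) (AllPairs.filter⁺ keep u) (All.filter⁺ keep important))

lemma4 : {n : ℕ} (G : Graph n) (A F : Subset n) → IsForest G F →
    (k : ℕ) → IsSw G A k →
    (xs : List (Fin n)) → Unique xs → All (Important G A F) xs →
    length xs ≤ 2 * k
lemma4 {n} G A F forest k (_ , maximal) xs u important =
  decidable-stable (_ ≤? _) λ ¬bound → adjacency-decidable (¬bound ∘ bound)
  where
  -- The bound is decidable, so we may assume that adjacency is.
  adjacency-decidable : ¬ ¬ Decidable (Graph.E G)
  adjacency-decidable = ¬¬-∀-Fin n λ x → ¬¬-∀-Fin n λ y → ¬¬-excluded-middle

  bound : Decidable (Graph.E G) → length xs ≤ 2 * k
  bound E? =
    let M₀ , cross₀ , disj₀ , _ , xs≤M₀ = important⇒matching G E? A F forest xs u important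
        M , M⊆M₀ , disj , nonadj , M₀≤2M =
          induced-submatching G E? forest M₀ (All.map (proj₂ ∘ proj₂) cross₀) disj₀
        M≤k = maximal M (crossInducedMatching G (anti-mono M⊆M₀ cross₀) disj nonadj)
    in ≤-trans xs≤M₀ (≤-trans M₀≤2M (*-monoʳ-≤ 2 M≤k))
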